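{- Let $\chi$ and $\check\phi$ be formulas over $\vec{x}$, $\vec{a}:\mathbb{Z}^d\to\mathbb{Z}^d$, and $\mathit{mf}:\mathbb{Z}^d\to\mathbb{Q}$ such that for all $\vec{x}\in\mathbb{Z}^d$: $\check\phi(\vec{x})\land\chi(\vec{x})\implies \mathit{mf}(\vec{x})-\mathit{mf}(\vec{a}(\vec{x}))\le 1$, and $\check\phi(\vec{x})\land\neg\chi(\vec{x})\implies\mathit{mf}(\vec{x})\le 0$. Then the conditional acceleration technique $(\langle\chi,\vec{a}\rangle,\check\phi)\mapsto \vec{x}'=\vec{a}^n(\vec{x})\land\chi(\vec{x})\land n<\mathit{mf}(\vec{x})+1$ is sound. Explicitly: for all $\vec{x},\vec{x}'\in\mathbb{Z}^d$ and $n>0$, if $\vec{x}\longrightarrow^n_{\langle\check\phi,\vec{a}\rangle}\vec{x}'$, $\vec{x}'=\vec{a}^n(\vec{x})$, $\chi(\vec{x})$ and $n<\mathit{mf}(\vec{x})+1$, then $\vec{x}\longrightarrow^n_{\langle\chi,\vec{a}\rangle}\vec{x}'$.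
   Context: $\vec{x}=(x_1,\dots,x_d)$ ranges over $\mathbb{Z}^d$, $n$ is a variable, $\vec{x}'=(x_1',\dots,x_d')$. Formulas are finite quantifier-free propositional formulas with atoms $p>0$, $p$ a closed-form arithmetic expression. For a formula $\phi$ over $\vec{x}$ and $\vec{a}:\mathbb{Z}^d\to\mathbb{Z}^d$, the loop $\langle\phi,\vec{a}\rangle$ induces $\vec{x}\longrightarrow_{\langle\phi,\vec{a}\rangle}\vec{x}'$ iff $\phi(\vec{x})\land\vec{x}'=\vec{a}(\vec{x})$; $\longrightarrow^n$ is its $n$-fold composition, and $\vec{a}^n$ is the $n$-fold application of $\vec{a}$ ($\vec{a}^0=\mathrm{id}$). A conditional acceleration technique is a partial function $\mathit{accel}$ mapping pairs (loop $\langle\chi,\vec{a}\rangle$, formula $\check\phi$) to formulas over $(\vec{x},n,\vec{x}')$; it is sound if for all arguments in its domain, $\vec{x},\vec{x}'\in\mathbb{Z}^d$, $n>0$: $\vec{x}\longrightarrow^n_{\langle\check\phi,\vec{a}\rangle}\vec{x}'\land\mathit{accel}(\langle\chi,\vec{a}\rangle,\check\phi)$ implies $\vec{x}\longrightarrow^n_{\langle\chi,\vec{a}\rangle}\vec{x}'$. -}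

module Defs where

open import Data.Nat using (ℕ; zero; suc)
open import Data.Integer using (ℤ)
open import Data.Rational using (ℚ; 0ℚ; _<_)
open import Data.Vec using (Vec)
open import Data.Product using (Σ; _×_)
open import Data.Sum using (_⊎_)
open import Data.Empty using (⊥)
open import Data.Unit using (⊤)
open import Relation.Nullary using (¬_)
open import Relation.Binary.PropositionalEquality using (_≡_)

Pt : ℕ → Set
Pt d = Vec ℤ d

-- Quantifier-free propositional formulas over x⃗ with atoms  p > 0,
-- where p is an (arbitrary) arithmetic expression in x⃗, modelled as a
-- function ℤ^d → ℚ.
data Formula (d : ℕ) : Set where
  atom  : (Pt d → ℚ) → Formula d
  ftrue : Formula d
  ffalse : Formula d
  fnot  : Formula d → Formula d
  fand  : Formula d → Formula d → Formula d
  for   : Formula d → Formula d → Formula d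

⟦_⟧ : ∀ {d} → Formula d → Pt d → Set
⟦ atom p ⟧ x = 0ℚ < p x
⟦ ftrue ⟧ x = ⊤
⟦ ffalse ⟧ x = ⊥
⟦ fnot φ ⟧ x = ¬ ⟦ φ ⟧ x
⟦ fand φ ψ ⟧ x = ⟦ φ ⟧ x × ⟦ ψ ⟧ x
⟦ for φ ψ ⟧ x = ⟦ φ ⟧ x ⊎ ⟦ ψ ⟧ x

Step : ∀ {d} → Formula d → (Pt d → Pt d) → Pt d → Pt d → Set
Step φ a x x' = ⟦ φ ⟧ x × x' ≡ a x

Steps : ∀ {d} → Formula d → (Pt d → Pt d) → ℕ → Pt d → Pt d → Set
Steps φ a zero x x' = x ≡ x'
Steps φ a (suc n) x x' = Σ (Pt _) λ y → Step φ a x y × Steps φ a n y x'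

iter : ∀ {d} → (Pt d → Pt d) → ℕ → Pt d → Pt d
iter a zero x = x
iter a (suc n) x = iter a n (a x)

{-# OPTIONS --safe #-}
module Submission where

open import Defs
open import Data.Nat using (ℕ; NonZero; zero; suc)
open import Data.Integer using (+_) renaming (_+_ to _+ℤ_; _*_ to _*ℤ_)
import Data.Integer.Properties as ℤ
open import Data.Rational using (ℚ; 0ℚ; 1ℚ; _≤_; _<_; _+_; _-_; _/_; -_; mkℚ)
open import Data.Rational.Properties
  using (normalize-coprime; /-cong; normalize-nonNeg; nonNegative⁻¹; +-monoˡ-<; +-monoˡ-≤; +-comm;
         <-irrefl; ≤-<-trans; <-≤-trans; _<?_; +-0-group; module ≤-Reasoning)
open import Algebra.Properties.Group +-0-group using (//-rightDividesˡ; //-rightDividesʳ)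
open import Data.Nat.Coprimality using (1-coprimeTo) renaming (sym to coprime-sym)
open import Data.Product using (_,_)
open import Data.Unit using (tt)
open import Relation.Nullary using (¬_; Dec; yes; no)
open import Relation.Nullary.Decidable using (¬?; _×-dec_; _⊎-dec_; decidable-stable)
open import Relation.Binary.PropositionalEquality using (_≡_; refl; sym; cong; subst; subst₂; module ≡-Reasoning)

⟦_⟧? : ∀ {d} (φ : Formula d) (x : Pt d) → Dec (⟦ φ ⟧ x)
⟦ atom p ⟧? x = 0ℚ <? p x
⟦ ftrue ⟧? x = yes tt
⟦ ffalse ⟧? x = no λ ()
⟦ fnot φ ⟧? x = ¬? (⟦ φ ⟧? x)
⟦ fand φ ψ ⟧? x = ⟦ φ ⟧? x ×-dec ⟦ ψ ⟧? x
⟦ for φ ψ ⟧? x = ⟦ φ ⟧? x ⊎-dec ⟦ ψ ⟧? x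

fromℕ : ℕ → ℚ
fromℕ n = + n / 1

fromℕ-suc : ∀ n → fromℕ (suc n) ≡ fromℕ n + 1ℚ
fromℕ-suc n = begin
  + suc n / 1                   ≡⟨ /-cong (ℤ.+-comm (+ 1) (+ n)) refl ⟩
  (+ n +ℤ + 1) / 1              ≡⟨ sym (/-cong numerator refl) ⟩
  mkℚ (+ n) 0 n/1-coprime + 1ℚ  ≡⟨ cong (_+ 1ℚ) (sym (normalize-coprime n/1-coprime)) ⟩
  fromℕ n + 1ℚ                  ∎
  where
  open ≡-Reasoning
  n/1-coprime = coprime-sym (1-coprimeTo n)
  numerator : + n *ℤ + 1 +ℤ + 1 *ℤ + 1 ≡ + n +ℤ + 1
  numerator = cong (_+ℤ + 1) (ℤ.*-identityʳ (+ n))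

fromℕ-nonNeg : ∀ n → 0ℚ ≤ fromℕ n
fromℕ-nonNeg n = nonNegative⁻¹ (fromℕ n) {{normalize-nonNeg n 1}}

p-q≤r⇒p≤r+q : ∀ {p q r} → p - q ≤ r → p ≤ r + q
p-q≤r⇒p≤r+q {p} {q} {r} p-q≤r = subst₂ _≤_ (//-rightDividesˡ q p) refl (+-monoˡ-≤ q p-q≤r)

+-cancelʳ-< : ∀ r {p q} → p + r < q + r → p < q
+-cancelʳ-< r {p} {q} p+r<q+r =
  subst₂ _<_ (//-rightDividesʳ r p) (//-rightDividesʳ r q) (+-monoˡ-< (- r) p+r<q+r)

module _ {d : ℕ} (χ φ̌ : Formula d) (a : Pt d → Pt d) (mf : Pt d → ℚ)
  (mf-decrease : ∀ x → ⟦ φ̌ ⟧ x → ⟦ χ ⟧ x → mf x - mf (a x) ≤ 1ℚ)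
  (mf-nonPos : ∀ x → ⟦ φ̌ ⟧ x → ¬ ⟦ χ ⟧ x → mf x ≤ 0ℚ) where

  -- Invariant: with m further steps to go, m < mf. As mf drops by at most 1 per
  -- step, it stays above 0 at every state before the last, where ¬ χ would force mf ≤ 0.
  φ̌-run⇒χ-run : ∀ m {x x'} → Steps φ̌ a (suc m) x x' → ⟦ χ ⟧ x → fromℕ m < mf x →
                Steps χ a (suc m) x x'
  φ̌-run⇒χ-run zero (y , (_ , y≡ax) , y⟶x') χx _ = y , (χx , y≡ax) , y⟶x'
  φ̌-run⇒χ-run (suc m) {x} (_ , (φ̌x , refl) , ax⟶x'@(_ , (φ̌ax , _) , _)) χx m+1<mf =
    a x , (χx , refl) , φ̌-run⇒χ-run m ax⟶x' χax m<mf-ax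
    where
    m<mf-ax : fromℕ m < mf (a x)
    m<mf-ax = +-cancelʳ-< 1ℚ (begin-strict
      fromℕ m + 1ℚ   ≡⟨ sym (fromℕ-suc m) ⟩
      fromℕ (suc m)  <⟨ m+1<mf ⟩
      mf x           ≤⟨ p-q≤r⇒p≤r+q (mf-decrease x φ̌x χx) ⟩
      1ℚ + mf (a x)  ≡⟨ +-comm 1ℚ (mf (a x)) ⟩
      mf (a x) + 1ℚ  ∎)
      where open ≤-Reasoning
    χax : ⟦ χ ⟧ (a x)
    χax = decidable-stable (⟦ χ ⟧? (a x)) λ ¬χax →
      <-irrefl refl (≤-<-trans (fromℕ-nonNeg m) (<-≤-trans m<mf-ax (mf-nonPos (a x) φ̌ax ¬χax)))

theorem9 : {d : ℕ} (χ φ̌ : Formula d) (a : Pt d → Pt d) (mf : Pt d → ℚ) →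
    (∀ x → ⟦ φ̌ ⟧ x → ⟦ χ ⟧ x → mf x - mf (a x) ≤ 1ℚ) →
    (∀ x → ⟦ φ̌ ⟧ x → ¬ ⟦ χ ⟧ x → mf x ≤ 0ℚ) →
    ∀ (x x' : Pt d) (n : ℕ) → .{{_ : NonZero n}} →
    Steps φ̌ a n x x' →
    x' ≡ iter a n x →
    ⟦ χ ⟧ x →
    (+ n / 1) < mf x + 1ℚ →
    Steps χ a n x x'
theorem9 χ φ̌ a mf mf-decrease mf-nonPos x x' zero run _ _ _ = run
theorem9 χ φ̌ a mf mf-decrease mf-nonPos x x' (suc m) run _ χx n<mf+1 =
  φ̌-run⇒χ-run χ φ̌ a mf mf-decrease mf-nonPos m run χx
    (+-cancelʳ-< 1ℚ (subst (_< mf x + 1ℚ) (fromℕ-suc m) n<mf+1))
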